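{- Call a basis element $[s_1,\dots,s_k]$ ($k\ge1$) of $\mathcal H_{\mathbb Z}$ leading positive if $s_1>0$. If $[\vec s]$ and $[\vec t]$ are leading positive basis elements, then $[\vec s]\sqcup\!\sqcup[\vec t]$ is a $\mathbb Q$-linear combination of leading positive basis elements.
   Context: Let $\mathcal H_{\mathbb Z}$ be the $\mathbb Q$-vector space with basis $\mathbf 1$ together with the formal symbols $[s_1,\dots,s_k]$ for $k\ge1$ and $(s_1,\dots,s_k)\in\mathbb Z^k$. Define linear maps on basis elements of positive depth by $I([s_1,s_2,\dots,s_k])=[s_1+1,s_2,\dots,s_k]$ and $J([s_1,s_2,\dots,s_k])=[s_1-1,s_2,\dots,s_k]$, and set $J(\mathbf 1)=0$. Notation: for a positive-depth basis element, write $[s_1,\dots,s_k]=[s_1,\vec s\,']$, where $[\vec s\,']=[s_2,\dots,s_k]$, or $\mathbf 1$ if $k=1$. For $a\in\mathbb Z$ and $X=\sum c_{\vec v}[\vec v]$, put $[a,X]:=\sum c_{\vec v}[a,\vec v]$, with $[a,\mathbf 1]:=[a]$. The extended shuffle product $\sqcup\!\sqcup$ is the bilinear product with two-sided unit $\mathbf 1$, defined on positive-depth basis elements by the following recursions: <ul> <li>(i) if $s_1=0$: $[0,\vec s\,']\sqcup\!\sqcup[t_1,\vec t\,']=[0,[\vec s\,']\sqcup\!\sqcup[t_1,\vec t\,']]$;</li> <li>(ii) if $s_1>0$ and $t_1=0$: $[s_1,\vec s\,']\sqcup\!\sqcup[0,\vec t\,']=[0,[s_1,\vec s\,']\sqcup\!\sqcup[\vec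 t\,']]$;</li> <li>(iii) if $s_1,t_1>0$: $[s_1,\vec s\,']\sqcup\!\sqcup[t_1,\vec t\,']=I([s_1,\vec s\,']\sqcup\!\sqcup[t_1-1,\vec t\,'])+I([s_1-1,\vec s\,']\sqcup\!\sqcup[t_1,\vec t\,'])$;</li> <li>(iv) if $s_1>0$ and $t_1<0$: $[s_1,\vec s\,']\sqcup\!\sqcup[t_1,\vec t\,']=J([s_1,\vec s\,']\sqcup\!\sqcup[t_1+1,\vec t\,'])-[s_1-1,\vec s\,']\sqcup\!\sqcup[t_1+1,\vec t\,']$;</li> <li>(v) if $s_1<0$: $[s_1,\vec s\,']\sqcup\!\sqcup[t_1,\vec t\,']=J([s_1+1,\vec s\,']\sqcup\!\sqcup[t_1,\vec t\,'])-[s_1+1,\vec s\,']\sqcup\!\sqcup[t_1-1,\vec t\,']$.</li> </ul> The recursions are well founded: (i) and (ii) by induction on total depth, (iii) on $s_1+t_1$, (iv) on $|t_1|$, and (v) on $|s_1|$. -}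

module Defs where

open import Data.List using (List; []; _∷_; map; _++_; foldr)
open import Data.List.Properties using (≡-dec)
open import Data.Product using (_×_; _,_)
open import Data.Integer as ℤ using (ℤ; +_; -[1+_]; _<_)
import Data.Integer.Properties as ℤP
open import Data.Nat using (ℕ; zero; suc)
open import Data.Rational as ℚ using (ℚ; 0ℚ; 1ℚ)
open import Data.Empty using (⊥)
open import Relation.Nullary using (yes; no)

-- A basis element of H_Z: the empty word [] stands for 𝟏,
-- a nonempty word (s₁ ∷ … ∷ sₖ) stands for [s₁,…,sₖ].
Word : Set
Word = List ℤ

-- An element of H_Z, as a finite formal Q-linear combination of basis
-- elements (a list of (coefficient, basis element) pairs; repeated
-- basis elements are allowed, their coefficients add up).
H : Set
H = List (ℚ × Word)

⟦_⟧ : Word → H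
⟦ w ⟧ = (1ℚ , w) ∷ []

0H : H
0H = []

_⊕_ : H → H → H
X ⊕ Y = X ++ Y

neg : H → H
neg = map (λ { (c , w) → (ℚ.- c , w) })

_⊖_ : H → H → H
X ⊖ Y = X ⊕ neg Y

coeff : Word → H → ℚ
coeff w [] = 0ℚ
coeff w ((c , v) ∷ X) with ≡-dec ℤP._≟_ w v
... | yes _ = c ℚ.+ coeff w X
... | no  _ = coeff w X

-- modify the first letter of every positive-depth term; terms equal to 𝟏 are dropped
-- (J(𝟏) = 0; I is only ever applied to combinations of positive-depth elements)
onHead : (ℤ → ℤ) → H → H
onHead f [] = []
onHead f ((c , []) ∷ X) = onHead f X
onHead f ((c , a ∷ w) ∷ X) = (c , f a ∷ w) ∷ onHead f X

I : H → H
I = onHead ℤ.suc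

J : H → H
J = onHead ℤ.pred

cons : ℤ → H → H
cons a = map (λ { (c , w) → (c , a ∷ w) })

-- The core recursion for [s₁, s'] ⧢ [t₁, t'] with fixed tails s', t'.
-- Parameters:  g b = [s'] ⧢ [b, t']      (used in case (i))
--              h c = [c, s'] ⧢ [t']      (used in case (ii))
module Core (g : ℤ → H) (h : ℤ → H) where

  -- s₁ = 0  (case (i))
  zeroS : ℤ → H
  zeroS b = cons (+ 0) (g b)

  -- s₁ = suc n > 0, t₁ = 0  (case (ii))
  posZ : ℕ → H
  posZ n = cons (+ 0) (h (+ suc n))

  -- s₁ = suc n > 0, t₁ = suc k > 0  (case (iii))
  posP : ℕ → ℕ → H
  posP n k = I (left n k) ⊕ I (right n k)
    where
      -- [s₁, s'] ⧢ [t₁ - 1, t']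
      left : ℕ → ℕ → H
      left n zero = posZ n
      left n (suc k) = posP n k
      -- [s₁ - 1, s'] ⧢ [t₁, t']
      right : ℕ → ℕ → H
      right zero k = zeroS (+ suc k)
      right (suc n) k = posP n k

  -- s₁ = suc n > 0, t₁ = -[1+ k] < 0  (case (iv))
  posN : ℕ → ℕ → H
  posN n zero = J (posZ n) ⊖ prevZ n
    where
      -- [s₁ - 1, s'] ⧢ [0, t']
      prevZ : ℕ → H
      prevZ zero = zeroS (+ 0)
      prevZ (suc n) = posZ n
  posN n (suc k) = J (posN n k) ⊖ prevN n k
    where
      -- [s₁ - 1, s'] ⧢ [t₁ + 1, t']
      prevN : ℕ → ℕ → H
      prevN zero k = zeroS -[1+ k ]
      prevN (suc n) k = posN n k

  pos : ℕ → ℤ → H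
  pos n (+ zero) = posZ n
  pos n (+ suc k) = posP n k
  pos n -[1+ k ] = posN n k

  -- s₁ = -[1+ m] < 0  (case (v))
  neg' : ℕ → ℤ → H
  neg' zero b = J (zeroS b) ⊖ zeroS (ℤ.pred b)
  neg' (suc m) b = J (neg' m b) ⊖ neg' m (ℤ.pred b)

  core : ℤ → ℤ → H
  core (+ zero) b = zeroS b
  core (+ suc n) b = pos n b
  core -[1+ m ] b = neg' m b

mutual
  sh : Word → Word → H
  sh [] t = ⟦ t ⟧
  sh (a ∷ s') t = shH s' t a

  -- shH s' t a = [a, s'] ⧢ [t]
  shH : Word → Word → ℤ → H
  shH s' [] a = ⟦ a ∷ s' ⟧
  shH s' (b ∷ t') a = Core.core (λ b' → sh s' (b' ∷ t')) (shH s' t') a b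

LeadingPositive : Word → Set
LeadingPositive [] = ⊥
LeadingPositive (a ∷ _) = + 0 < a

{-# OPTIONS --safe #-}
-- In case (iii) the product is I applied to two products whose leading letters are
-- non-negative: either case (i)/(ii) fired, producing [0, …], or case (iii) fired again.
-- Since I raises a non-negative leading letter to a positive one, induction on s₁ + t₁
-- shows that every term of a product of two leading positive elements is leading positive.
module Submission where

open import Defs
open import Data.Rational using (0ℚ)
open import Relation.Binary.PropositionalEquality using (_≡_; refl)
open import Relation.Nullary using (¬_; yes; no)
open import Data.List using ([]; _∷_)
open import Data.List.Properties using (≡-dec)
open import Data.List.Relation.Unary.All as All using (All; []; _∷_)
open import Data.List.Relation.Unary.All.Properties using (++⁺)
open import Data.Product using (_,_; proj₂)
open import Data.Integer as ℤ using (ℤ; +_; +<+; +≤+)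
import Data.Integer.Properties as ℤP
open import Data.Nat using (zero; suc; z≤n)
open import Data.Empty using (⊥; ⊥-elim)
open import Function using (_∘_)

Supported : (Word → Set) → H → Set
Supported P = All (P ∘ proj₂)

coeff-unsupported : ∀ {P : Word → Set} w X → ¬ P w → Supported P X → coeff w X ≡ 0ℚ
coeff-unsupported w []            ¬Pw []         = refl
coeff-unsupported w ((c , v) ∷ X) ¬Pw (Pv ∷ PX) with ≡-dec ℤP._≟_ w v
... | yes refl = ⊥-elim (¬Pw Pv)
... | no  _    = coeff-unsupported w X ¬Pw PX

LeadingNonNegative : Word → Set
LeadingNonNegative []      = ⊥
LeadingNonNegative (a ∷ _) = + 0 ℤ.≤ a

leadingPositive⇒leadingNonNegative : ∀ w → LeadingPositive w → LeadingNonNegative w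
leadingPositive⇒leadingNonNegative (a ∷ _) = ℤP.<⇒≤

cons-leadingNonNegative : ∀ {a} → + 0 ℤ.≤ a → ∀ X → Supported LeadingNonNegative (cons a X)
cons-leadingNonNegative 0≤a []      = []
cons-leadingNonNegative 0≤a (_ ∷ X) = 0≤a ∷ cons-leadingNonNegative 0≤a X

I-leadingPositive : ∀ X → Supported LeadingNonNegative X → Supported LeadingPositive (I X)
I-leadingPositive []                []         = []
I-leadingPositive ((c , a ∷ w) ∷ X) (0≤a ∷ PX) =
  ℤP.suc[i]≤j⇒i<j (ℤP.suc-mono 0≤a) ∷ I-leadingPositive X PX

module CoreSigns (g h : ℤ → H) where
  open Core g h

  mutual
    core-leadingNonNegative : ∀ m k → Supported LeadingNonNegative (core (+ m) (+ k))
    core-leadingNonNegative zero    k       = cons-leadingNonNegative (+≤+ z≤n) (g (+ k))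
    core-leadingNonNegative (suc n) zero    = cons-leadingNonNegative (+≤+ z≤n) (h (+ suc n))
    core-leadingNonNegative (suc n) (suc k) =
      All.map (leadingPositive⇒leadingNonNegative _) (posP-leadingPositive n k)

    -- posP n k unfolds to this only once n and k are split, hence the four clauses below.
    caseIII-leadingPositive : ∀ n k →
      Supported LeadingPositive (I (core (+ suc n) (+ k)) ⊕ I (core (+ n) (+ suc k)))
    caseIII-leadingPositive n k =
      ++⁺ (I-leadingPositive _ (core-leadingNonNegative (suc n) k))
          (I-leadingPositive _ (core-leadingNonNegative n (suc k)))

    posP-leadingPositive : ∀ n k → Supported LeadingPositive (posP n k)
    posP-leadingPositive zero    zero    = caseIII-leadingPositive zero    zero
    posP-leadingPositive zero    (suc k) = caseIII-leadingPositive zero    (suc k)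
    posP-leadingPositive (suc n) zero    = caseIII-leadingPositive (suc n) zero
    posP-leadingPositive (suc n) (suc k) = caseIII-leadingPositive (suc n) (suc k)

lemma2p10 : (s t : Word) → LeadingPositive s → LeadingPositive t →
    (w : Word) → ¬ LeadingPositive w → coeff w (sh s t) ≡ 0ℚ
lemma2p10 (+ suc n ∷ s') (+ suc k ∷ t') _ _ w ¬LPw =
  coeff-unsupported w _ ¬LPw
    (CoreSigns.posP-leadingPositive (λ b → sh s' (b ∷ t')) (shH s' t') n k)
lemma2p10 (+ zero ∷ s') t             (+<+ ()) _
lemma2p10 (+ suc n ∷ s') (+ zero ∷ t') _        (+<+ ())
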